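{- Let $f\colon\{0,\dots,n\}\to\mathbb{Z}$ and $g\colon\{0,\dots,m\}\to\mathbb{Z}$, with $\Delta$ and $R_{2\Delta}$ as in the context. Let $I\subseteq\{0,\dots,n\}$ and $J\subseteq\{0,\dots,m\}$ be intervals of integers of the same length $|I|=|J|$. If $I\times J\subseteq R_{2\Delta}$, then the sumset $\{(i,f(i)): i\in I\}+\{(j,g(j)): j\in J\}$ has size $O(\Delta\cdot(|I|+|J|))$.
   Context: $\breve f$ is the pointwise maximal convex function $\{0,\dots,n\}\to\mathbb{Q}$ with $\breve f\le f$, similarly $\breve g$. $\Delta_f:=\max\{1,\max_i(f(i)-\breve f(i))\}$, $\Delta_g:=\max\{1,\max_j(g(j)-\breve g(j))\}$, $\Delta:=\max\{\Delta_f,\Delta_g\}$. $\breve h(k)=\min\{\breve f(i)+\breve g(j):i+j=k,\ 0\le i\le n,\ 0\le j\le m\}$. A point $(i,j)$ is $\delta$-relevant if $\breve f(i)+\breve g(j)\le\breve h(i+j)+\delta$; $R_\delta$ is the set of $\delta$-relevant points. The sumset of two sets of points in $\mathbb{Z}^2$ is the set of all componentwise sums. -}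

module Defs where

open import Data.Nat as ℕ using (ℕ; suc)
open import Data.Integer as ℤ using (ℤ)
open import Data.Rational using (ℚ; _+_; _-_; _*_; _≤_; _⊔_; 1ℚ; _/_)
open import Data.Fin using (Fin; toℕ)
open import Data.List using (List; foldr; map; allFin)
open import Data.Product using (_×_; _,_; Σ; ∃)
open import Relation.Binary.PropositionalEquality using (_≡_)

ℤ→ℚ : ℤ → ℚ
ℤ→ℚ z = z / 1

ℕ→ℚ : ℕ → ℚ
ℕ→ℚ k = ℤ.+ k / 1

Convex : ∀ {n} → (Fin (suc n) → ℚ) → Set
Convex {n} φ = ∀ (a b c : Fin (suc n)) → toℕ a ℕ.< toℕ b → toℕ b ℕ.< toℕ c →
  ℕ→ℚ (toℕ c ℕ.∸ toℕ a) * φ b ≤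
  ℕ→ℚ (toℕ c ℕ.∸ toℕ b) * φ a + ℕ→ℚ (toℕ b ℕ.∸ toℕ a) * φ c

IsLowerEnvelope : ∀ {n} → (Fin (suc n) → ℤ) → (Fin (suc n) → ℚ) → Set
IsLowerEnvelope {n} f φ =
  Convex φ × (∀ i → φ i ≤ ℤ→ℚ (f i)) ×
  (∀ (ψ : Fin (suc n) → ℚ) → Convex ψ → (∀ i → ψ i ≤ ℤ→ℚ (f i)) → ∀ i → ψ i ≤ φ i)

Δof : ∀ {n} → (Fin (suc n) → ℤ) → (Fin (suc n) → ℚ) → ℚ
Δof {n} f φ = foldr _⊔_ 1ℚ (map (λ i → ℤ→ℚ (f i) - φ i) (allFin (suc n)))

-- (i,j) is δ-relevant: f̆(i)+ğ(j) ≤ h̆(i+j)+δ, where h̆(k) = min{f̆(i')+ğ(j') : i'+j'=k};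
-- written out as: f̆(i)+ğ(j) ≤ f̆(i')+ğ(j')+δ for every (i',j') in range with i'+j' = i+j
Relevant : ∀ {n m} → (Fin (suc n) → ℚ) → (Fin (suc m) → ℚ) → ℚ →
           Fin (suc n) → Fin (suc m) → Set
Relevant {n} {m} φ γ δ i j = ∀ (i' : Fin (suc n)) (j' : Fin (suc m)) →
  toℕ i' ℕ.+ toℕ j' ≡ toℕ i ℕ.+ toℕ j → φ i + γ j ≤ (φ i' + γ j') + δ

InSumset : ∀ {n m} → (Fin (suc n) → ℤ) → (Fin (suc m) → ℤ) →
           (a b ℓ : ℕ) → ℤ × ℤ → Set
InSumset {n} {m} f g a b ℓ p =
  Σ (Fin (suc n)) λ i → Σ (Fin (suc m)) λ j →
    (a ℕ.≤ toℕ i) × (toℕ i ℕ.< a ℕ.+ ℓ) × (b ℕ.≤ toℕ j) × (toℕ j ℕ.< b ℕ.+ ℓ) ×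
    (p ≡ (ℤ.+ (toℕ i ℕ.+ toℕ j) , f i ℤ.+ g j))

-- Every point of the sumset lies in one of the 2ℓ columns x = i + j with a + b ≤ x < a + b + 2ℓ.
-- Two points (i + j, f i + g j) and (i' + j', f i' + g j') of one column have heights within 4Δ:
-- f i + g j ≤ f̆ i + ğ j + 2Δ by definition of Δ, ≤ f̆ i' + ğ j' + 4Δ by the 2Δ-relevance of (i, j),
-- and ≤ f i' + g j' + 4Δ since f̆ ≤ f. So a column carries at most 8Δ + 1 ≤ 9Δ integer points.

{-# OPTIONS --safe #-}
module Submission where

open import Defs
open import Data.Nat as ℕ using (ℕ; suc)
open import Data.Integer as ℤ using (ℤ)
open import Data.Rational using (ℚ; _+_; _*_; _≤_; _⊔_)
open import Data.Fin using (Fin; toℕ)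
open import Data.List using (List; length)
open import Data.List.Relation.Unary.All using (All)
open import Data.List.Relation.Unary.Unique.Propositional using (Unique)
open import Data.Product using (_×_; Σ)

import Data.Nat.Properties as ℕP
import Data.Nat.Tactic.RingSolver as ℕSolver
import Data.Integer.Properties as ℤP
open import Algebra.Properties.AbelianGroup ℤP.+-0-abelianGroup using (∙-cancelʳ)
open import Data.Integer.Tactic.RingSolver using (solve-∀)
open import Data.Rational using (toℚᵘ; _-_; -_; 0ℚ; 1ℚ; nonNegative)
open import Data.Rational.Properties
open import Data.Rational.Solver using (module +-*-Solver)
open +-*-Solver using (solve; _:+_; _:*_; _:-_; _:=_; con)
open import Data.Rational.Unnormalised as ℚᵘ using (ℚᵘ; mkℚᵘ; *≡*)
import Data.Rational.Unnormalised.Properties as ℚᵘP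
open import Data.Fin using (fromℕ<; combine; zero; suc)
open import Data.Fin.Properties using (injective⇒≤; fromℕ<-injective; combine-injective)
open import Data.List using ([]; _∷_; foldr; map; lookup; allFin)
open import Data.List.Properties using (foldr-preservesᵇ; foldr-preservesʳ; foldr-preservesᵒ)
open import Data.List.Membership.Propositional using (_∈_)
open import Data.List.Membership.Propositional.Properties using (∈-lookup; ∈-map⁺; ∈-allFin)
open import Data.List.Relation.Unary.All as All using (_∷_)
import Data.List.Relation.Unary.All.Properties as AllP
open import Data.List.Relation.Unary.AllPairs using (_∷_)
open import Data.List.Relation.Unary.Any as Any using (here; there)
open import Data.Product using (_,_; proj₁; proj₂)
open import Data.Sum using (inj₂; [_,_]′)
open import Relation.Binary.PropositionalEquality
open import Relation.Nullary using (yes; no; contradiction)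

private
  ℤ→ℚᵘ : ℤ → ℚᵘ
  ℤ→ℚᵘ z = mkℚᵘ z 0

  toℚᵘ-ℤ→ℚ : ∀ z → toℚᵘ (ℤ→ℚ z) ℚᵘ.≃ ℤ→ℚᵘ z
  toℚᵘ-ℤ→ℚ z = toℚᵘ-fromℚᵘ (ℤ→ℚᵘ z)

ℤ→ℚ-+ : ∀ x y → ℤ→ℚ (x ℤ.+ y) ≡ ℤ→ℚ x + ℤ→ℚ y
ℤ→ℚ-+ x y = toℚᵘ-injective (begin
  toℚᵘ (ℤ→ℚ (x ℤ.+ y))           ≈⟨ toℚᵘ-ℤ→ℚ (x ℤ.+ y) ⟩
  ℤ→ℚᵘ (x ℤ.+ y)                 ≈⟨ *≡* (identity x y) ⟩
  ℤ→ℚᵘ x ℚᵘ.+ ℤ→ℚᵘ y              ≈⟨ ℚᵘP.+-cong (toℚᵘ-ℤ→ℚ x) (toℚᵘ-ℤ→ℚ y) ⟨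
  toℚᵘ (ℤ→ℚ x) ℚᵘ.+ toℚᵘ (ℤ→ℚ y)  ≈⟨ toℚᵘ-homo-+ (ℤ→ℚ x) (ℤ→ℚ y) ⟨
  toℚᵘ (ℤ→ℚ x + ℤ→ℚ y)           ∎)
  where
  open ℚᵘP.≃-Reasoning
  identity : ∀ x y → (x ℤ.+ y) ℤ.* ℤ.+ 1 ≡ (x ℤ.* ℤ.+ 1 ℤ.+ y ℤ.* ℤ.+ 1) ℤ.* ℤ.+ 1
  identity = solve-∀

ℤ→ℚ-* : ∀ x y → ℤ→ℚ (x ℤ.* y) ≡ ℤ→ℚ x * ℤ→ℚ y
ℤ→ℚ-* x y = toℚᵘ-injective (begin
  toℚᵘ (ℤ→ℚ (x ℤ.* y))           ≈⟨ toℚᵘ-ℤ→ℚ (x ℤ.* y) ⟩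
  ℤ→ℚᵘ x ℚᵘ.* ℤ→ℚᵘ y              ≈⟨ ℚᵘP.*-cong (toℚᵘ-ℤ→ℚ x) (toℚᵘ-ℤ→ℚ y) ⟨
  toℚᵘ (ℤ→ℚ x) ℚᵘ.* toℚᵘ (ℤ→ℚ y)  ≈⟨ toℚᵘ-homo-* (ℤ→ℚ x) (ℤ→ℚ y) ⟨
  toℚᵘ (ℤ→ℚ x * ℤ→ℚ y)           ∎)
  where open ℚᵘP.≃-Reasoning

ℤ→ℚ-neg : ∀ x → ℤ→ℚ (ℤ.- x) ≡ - ℤ→ℚ x
ℤ→ℚ-neg x = toℚᵘ-injective (begin
  toℚᵘ (ℤ→ℚ (ℤ.- x))  ≈⟨ toℚᵘ-ℤ→ℚ (ℤ.- x) ⟩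
  ℚᵘ.- ℤ→ℚᵘ x          ≈⟨ ℚᵘP.-‿cong (toℚᵘ-ℤ→ℚ x) ⟨
  ℚᵘ.- toℚᵘ (ℤ→ℚ x)    ≈⟨ toℚᵘ-homo‿- (ℤ→ℚ x) ⟨
  toℚᵘ (- ℤ→ℚ x)      ∎)
  where open ℚᵘP.≃-Reasoning

ℤ→ℚ-mono-≤ : ∀ {x y} → x ℤ.≤ y → ℤ→ℚ x ≤ ℤ→ℚ y
ℤ→ℚ-mono-≤ {x} {y} x≤y = toℚᵘ-cancel-≤
  (ℚᵘP.≤-respʳ-≃ (ℚᵘP.≃-sym (toℚᵘ-ℤ→ℚ y)) (ℚᵘP.≤-respˡ-≃ (ℚᵘP.≃-sym (toℚᵘ-ℤ→ℚ x))
    (ℚᵘ.*≤* (ℤP.*-monoʳ-≤-nonNeg (ℤ.+ 1) x≤y))))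

ℕ→ℚ-+ : ∀ k l → ℕ→ℚ (k ℕ.+ l) ≡ ℕ→ℚ k + ℕ→ℚ l
ℕ→ℚ-+ k l = trans (cong ℤ→ℚ (ℤP.pos-+ k l)) (ℤ→ℚ-+ (ℤ.+ k) (ℤ.+ l))

ℕ→ℚ-* : ∀ k l → ℕ→ℚ (k ℕ.* l) ≡ ℕ→ℚ k * ℕ→ℚ l
ℕ→ℚ-* k l = trans (cong ℤ→ℚ (ℤP.pos-* k l)) (ℤ→ℚ-* (ℤ.+ k) (ℤ.+ l))

ℕ→ℚ-mono-≤ : ∀ {k l} → k ℕ.≤ l → ℕ→ℚ k ≤ ℕ→ℚ l
ℕ→ℚ-mono-≤ k≤l = ℤ→ℚ-mono-≤ (ℤ.+≤+ k≤l)

0≤ℕ→ℚ : ∀ k → 0ℚ ≤ ℕ→ℚ k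
0≤ℕ→ℚ k = ℕ→ℚ-mono-≤ {0} {k} ℕ.z≤n

x≤y+E⇒x-y≤E : ∀ x y {E} → ℤ→ℚ x ≤ ℤ→ℚ y + E → ℤ→ℚ (x ℤ.- y) ≤ E
x≤y+E⇒x-y≤E x y {E} x≤y+E = begin
  ℤ→ℚ (x ℤ.- y)           ≡⟨ trans (ℤ→ℚ-+ x (ℤ.- y)) (cong (ℤ→ℚ x +_) (ℤ→ℚ-neg y)) ⟩
  ℤ→ℚ x - ℤ→ℚ y           ≤⟨ +-monoˡ-≤ (- ℤ→ℚ y) x≤y+E ⟩
  (ℤ→ℚ y + E) - ℤ→ℚ y     ≡⟨ solve 2 (λ u e → (u :+ e) :- u := e) refl (ℤ→ℚ y) E ⟩
  E                       ∎
  where open ≤-Reasoning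

∣x-y∣≤E : ∀ x y {E} → ℤ→ℚ x ≤ ℤ→ℚ y + E → ℤ→ℚ y ≤ ℤ→ℚ x + E → ℕ→ℚ ℤ.∣ x ℤ.- y ∣ ≤ E
∣x-y∣≤E x y x≤y+E y≤x+E = by-sign (x ℤ.- y)
  (x≤y+E⇒x-y≤E x y x≤y+E)
  (subst (λ z → ℤ→ℚ z ≤ _) (sym (neg-diff x y)) (x≤y+E⇒x-y≤E y x y≤x+E))
  where
  neg-diff : ∀ x y → ℤ.- (x ℤ.- y) ≡ y ℤ.- x
  neg-diff = solve-∀
  by-sign : ∀ {E} z → ℤ→ℚ z ≤ E → ℤ→ℚ (ℤ.- z) ≤ E → ℕ→ℚ ℤ.∣ z ∣ ≤ E
  by-sign (ℤ.+ _)    z≤E _  = z≤E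
  by-sign ℤ.-[1+ _ ] _ -z≤E = -z≤E

1≤Δof : ∀ {n} (f : Fin (suc n) → ℤ) φ → 1ℚ ≤ Δof f φ
1≤Δof {n} f φ = foldr-preservesʳ {P = 1ℚ ≤_} {f = _⊔_} (λ x → p≤q⇒p≤r⊔q x) ≤-refl
  (map (λ i → ℤ→ℚ (f i) - φ i) (allFin (suc n)))

f≤φ+Δof : ∀ {n} (f : Fin (suc n) → ℤ) φ i → ℤ→ℚ (f i) ≤ φ i + Δof f φ
f≤φ+Δof {n} f φ i = begin
  ℤ→ℚ (f i)                         ≡⟨ solve 2 (λ u v → u := v :+ (u :- v)) refl (ℤ→ℚ (f i)) (φ i) ⟩
  φ i + (ℤ→ℚ (f i) - φ i)           ≤⟨ +-monoʳ-≤ (φ i) gap≤Δ ⟩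
  φ i + Δof f φ                     ∎
  where
  open ≤-Reasoning
  gap : Fin (suc n) → ℚ
  gap k = ℤ→ℚ (f k) - φ k
  gap≤Δ : gap i ≤ Δof f φ
  gap≤Δ = foldr-preservesᵒ {P = gap i ≤_} {f = _⊔_} (λ x y → [ p≤q⇒p≤q⊔r y , p≤q⇒p≤r⊔q x ]′)
    1ℚ (map gap (allFin (suc n))) (inj₂ (Any.map ≤-reflexive (∈-map⁺ gap (∈-allFin i))))

lookup-injective : ∀ {A : Set} {xs : List A} → Unique xs → ∀ {i j} → lookup xs i ≡ lookup xs j → i ≡ j
lookup-injective (_     ∷ _)  {zero}  {zero}  _ = refl
lookup-injective (x∉xs ∷ _)  {zero}  {suc j} e = contradiction e (All.lookup x∉xs (∈-lookup j))
lookup-injective (x∉xs ∷ _)  {suc i} {zero}  e = contradiction (sym e) (All.lookup x∉xs (∈-lookup i))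
lookup-injective (_     ∷ u) {suc i} {suc j} e = cong suc (lookup-injective u e)

Unique⇒length≤ : ∀ {A : Set} {P : A → Set} {xs : List A} {M} → Unique xs → All P xs →
  (index : ∀ x → P x → Fin M) → (∀ {x y} (px : P x) (py : P y) → index x px ≡ index y py → x ≡ y) →
  length xs ℕ.≤ M
Unique⇒length≤ {xs = xs} u ps index index-injective =
  injective⇒≤ {f = λ i → index (lookup xs i) (All.lookup ps (∈-lookup i))}
    (λ e → lookup-injective u (index-injective _ _ e))

shift-nonNeg : ∀ {N} z → ℤ.∣ z ∣ ℕ.≤ N → Σ ℕ λ k → z ℤ.+ ℤ.+ N ≡ ℤ.+ k × k ℕ.≤ N ℕ.+ N
shift-nonNeg {N} (ℤ.+ k)    k≤N = k ℕ.+ N , refl , ℕP.+-monoˡ-≤ N k≤N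
shift-nonNeg {N} ℤ.-[1+ k ] k<N =
  N ℕ.∸ suc k , ℤP.⊖-≥ k<N , ℕP.≤-trans (ℕP.m∸n≤m N (suc k)) (ℕP.m≤m+n N N)

height-index : ∀ {N} z → ℤ.∣ z ∣ ℕ.≤ N → Fin (suc (N ℕ.+ N))
height-index z z≤N = fromℕ< (ℕ.s≤s (proj₂ (proj₂ (shift-nonNeg z z≤N))))

height-index-injective : ∀ {N} z z' (z≤N : ℤ.∣ z ∣ ℕ.≤ N) (z'≤N : ℤ.∣ z' ∣ ℕ.≤ N) →
  height-index z z≤N ≡ height-index z' z'≤N → z ≡ z'
height-index-injective {N} z z' z≤N z'≤N e = ∙-cancelʳ (ℤ.+ N) z z' (begin
  z ℤ.+ ℤ.+ N    ≡⟨ proj₁ (proj₂ (shift-nonNeg z z≤N)) ⟩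
  ℤ.+ _          ≡⟨ cong ℤ.+_ (fromℕ<-injective _ _ _ _ e) ⟩
  ℤ.+ _          ≡⟨ proj₁ (proj₂ (shift-nonNeg z' z'≤N)) ⟨
  z' ℤ.+ ℤ.+ N   ∎)
  where open ≡-Reasoning

module _ (c w : ℕ) where

  InColumns : ℤ × ℤ → Set
  InColumns (x , _) = Σ ℕ λ s → x ≡ ℤ.+ s × c ℕ.≤ s × s ℕ.< c ℕ.+ w

  column-index : ∀ p → InColumns p → Fin w
  column-index _ (s , _ , c≤s , s<c+w) =
    fromℕ< (subst (s ℕ.∸ c ℕ.<_) (ℕP.m+n∸m≡n c w) (ℕP.∸-monoˡ-< s<c+w c≤s))

  column-index-injective : ∀ {p q} (cp : InColumns p) (cq : InColumns q) →
    column-index p cp ≡ column-index q cq → proj₁ p ≡ proj₁ q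
  column-index-injective (s , refl , c≤s , _) (s' , refl , c≤s' , _) e =
    cong ℤ.+_ (ℕP.∸-cancelʳ-≡ c≤s c≤s' (fromℕ<-injective _ _ _ _ e))

  length≤-near-graph : ∀ (B : ℤ → ℤ) N {L} → Unique L → All InColumns L →
    All (λ p → ℤ.∣ proj₂ p ℤ.- B (proj₁ p) ∣ ℕ.≤ N) L → length L ℕ.≤ w ℕ.* suc (N ℕ.+ N)
  length≤-near-graph B N uniq columns near =
    Unique⇒length≤ {P = Near} uniq (All.zip (columns , near)) index index-injective
    where
    Near : ℤ × ℤ → Set
    Near p = InColumns p × ℤ.∣ proj₂ p ℤ.- B (proj₁ p) ∣ ℕ.≤ N
    index : ∀ p → Near p → Fin (w ℕ.* suc (N ℕ.+ N))
    index p (cp , np) = combine (column-index p cp) (height-index (proj₂ p ℤ.- B (proj₁ p)) np)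
    index-injective : ∀ {p q} (hp : Near p) (hq : Near q) → index p hp ≡ index q hq → p ≡ q
    index-injective {x , y} {x' , y'} (cp , np) (cq , nq) e
      with same-column , same-height ← combine-injective _ _ _ _ e
      with refl ← column-index-injective {x , y} {x' , y'} cp cq same-column
      = cong (x ,_) (∙-cancelʳ (ℤ.- B x) y y'
          (height-index-injective (y ℤ.- B x) (y' ℤ.- B x) np nq same-height))

columnBase : List (ℤ × ℤ) → ℤ → ℤ
columnBase []              _ = ℤ.+ 0
columnBase ((x' , y') ∷ L) x with x' ℤ.≟ x
... | yes _ = y'
... | no  _ = columnBase L x

columnBase-∈ : ∀ L {x y} → (x , y) ∈ L → (x , columnBase L x) ∈ L
columnBase-∈ ((x' , y') ∷ L) {x} p∈L with x' ℤ.≟ x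
... | yes refl = here refl
columnBase-∈ ((x' , y') ∷ L) (here refl) | no x'≢x = contradiction refl x'≢x
columnBase-∈ ((x' , y') ∷ L) (there p∈L) | no _    = there (columnBase-∈ L p∈L)

length≤-columns-spread : ∀ c w {E} L → 0ℚ ≤ E → Unique L → All (InColumns c w) L →
  (∀ {p q} → p ∈ L → q ∈ L → proj₁ p ≡ proj₁ q → ℕ→ℚ ℤ.∣ proj₂ p ℤ.- proj₂ q ∣ ≤ E) →
  ℕ→ℚ (length L) ≤ ℕ→ℚ w * (1ℚ + (E + E))
length≤-columns-spread c w {E} L 0≤E uniq columns spread = begin
  ℕ→ℚ (length L)                   ≤⟨ ℕ→ℚ-mono-≤ (length≤-near-graph c w B N uniq columns (All.tabulate height≤N)) ⟩
  ℕ→ℚ (w ℕ.* suc (N ℕ.+ N))        ≡⟨ ℕ→ℚ-* w (suc (N ℕ.+ N)) ⟩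
  ℕ→ℚ w * ℕ→ℚ (1 ℕ.+ (N ℕ.+ N))    ≡⟨ cong (ℕ→ℚ w *_) (trans (ℕ→ℚ-+ 1 (N ℕ.+ N)) (cong (1ℚ +_) (ℕ→ℚ-+ N N))) ⟩
  ℕ→ℚ w * (1ℚ + (ℕ→ℚ N + ℕ→ℚ N))   ≤⟨ *-monoˡ-≤-nonNeg (ℕ→ℚ w) {{nonNegative (0≤ℕ→ℚ w)}}
                                        (+-monoʳ-≤ 1ℚ (+-mono-≤ N≤E N≤E)) ⟩
  ℕ→ℚ w * (1ℚ + (E + E))           ∎
  where
  open ≤-Reasoning
  B = columnBase L
  height : ℤ × ℤ → ℕ
  height p = ℤ.∣ proj₂ p ℤ.- B (proj₁ p) ∣
  N = foldr ℕ._⊔_ 0 (map height L)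
  height≤N : ∀ {p} → p ∈ L → height p ℕ.≤ N
  height≤N {p} p∈L = foldr-preservesᵒ {P = height p ℕ.≤_} (λ k l → [ ℕP.m≤n⇒m≤n⊔o l , ℕP.m≤n⇒m≤o⊔n k ]′)
    0 (map height L) (inj₂ (Any.map ℕP.≤-reflexive (∈-map⁺ height p∈L)))
  height≤E : ∀ {p} → p ∈ L → ℕ→ℚ (height p) ≤ E
  height≤E {x , y} p∈L = spread p∈L (columnBase-∈ L p∈L) refl
  ⊔-preserves : ∀ {P : ℕ → Set} k l → P k → P l → P (k ℕ.⊔ l)
  ⊔-preserves {P} k l Pk Pl = [ (λ e → subst P (sym e) Pk) , (λ e → subst P (sym e) Pl) ]′ (ℕP.⊔-sel k l)
  N≤E : ℕ→ℚ N ≤ E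
  N≤E = foldr-preservesᵇ {P = λ k → ℕ→ℚ k ≤ E} (λ {k} {l} → ⊔-preserves k l) 0≤E
    (AllP.map⁺ (All.tabulate height≤E))

sumset⊆columns : ∀ {n m} {f : Fin (suc n) → ℤ} {g : Fin (suc m) → ℤ} {a b ℓ p} →
  InSumset f g a b ℓ p → InColumns (a ℕ.+ b) (ℓ ℕ.+ ℓ) p
sumset⊆columns {a = a} {b} {ℓ} (i , j , a≤i , i<a+ℓ , b≤j , j<b+ℓ , refl) =
  toℕ i ℕ.+ toℕ j , refl , ℕP.+-mono-≤ a≤i b≤j ,
  subst (toℕ i ℕ.+ toℕ j ℕ.<_) (interchange a b ℓ) (ℕP.+-mono-<-≤ i<a+ℓ (ℕP.<⇒≤ j<b+ℓ))
  where
  interchange : ∀ a b ℓ → (a ℕ.+ ℓ) ℕ.+ (b ℕ.+ ℓ) ≡ (a ℕ.+ b) ℕ.+ (ℓ ℕ.+ ℓ)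
  interchange = ℕSolver.solve-∀

RelevantBox : ∀ {n m} → (Fin (suc n) → ℚ) → (Fin (suc m) → ℚ) → ℚ → (a b ℓ : ℕ) → Set
RelevantBox f̆ ğ δ a b ℓ = ∀ i j →
  a ℕ.≤ toℕ i → toℕ i ℕ.< a ℕ.+ ℓ → b ℕ.≤ toℕ j → toℕ j ℕ.< b ℕ.+ ℓ → Relevant f̆ ğ δ i j

module _ {n m} {f : Fin (suc n) → ℤ} {g : Fin (suc m) → ℤ} {f̆ : Fin (suc n) → ℚ} {ğ : Fin (suc m) → ℚ}
         (f̆≤f : ∀ i → f̆ i ≤ ℤ→ℚ (f i)) (ğ≤g : ∀ j → ğ j ≤ ℤ→ℚ (g j)) where

  relevant⇒sum≤ : ∀ {δ i j i' j'} → Relevant f̆ ğ δ i j → toℕ i' ℕ.+ toℕ j' ≡ toℕ i ℕ.+ toℕ j →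
    ℤ→ℚ (f i ℤ.+ g j) ≤ ℤ→ℚ (f i' ℤ.+ g j') + (δ + (Δof f f̆ + Δof g ğ))
  relevant⇒sum≤ {δ} {i} {j} {i'} {j'} rel same-column = begin
    ℤ→ℚ (f i ℤ.+ g j)                        ≡⟨ ℤ→ℚ-+ (f i) (g j) ⟩
    ℤ→ℚ (f i) + ℤ→ℚ (g j)                    ≤⟨ +-mono-≤ (f≤φ+Δof f f̆ i) (f≤φ+Δof g ğ j) ⟩
    (f̆ i + Δf) + (ğ j + Δg)                  ≡⟨ solve 4 (λ u v p q → (u :+ p) :+ (v :+ q) := (u :+ v) :+ (p :+ q))
                                                   refl (f̆ i) (ğ j) Δf Δg ⟩
    (f̆ i + ğ j) + (Δf + Δg)                  ≤⟨ +-monoˡ-≤ (Δf + Δg) (rel i' j' same-column) ⟩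
    ((f̆ i' + ğ j') + δ) + (Δf + Δg)          ≤⟨ +-monoˡ-≤ (Δf + Δg) (+-monoˡ-≤ δ (+-mono-≤ (f̆≤f i') (ğ≤g j'))) ⟩
    ((ℤ→ℚ (f i') + ℤ→ℚ (g j')) + δ) + (Δf + Δg) ≡⟨ +-assoc (ℤ→ℚ (f i') + ℤ→ℚ (g j')) δ (Δf + Δg) ⟩
    (ℤ→ℚ (f i') + ℤ→ℚ (g j')) + (δ + (Δf + Δg)) ≡⟨ cong (_+ (δ + (Δf + Δg))) (ℤ→ℚ-+ (f i') (g j')) ⟨
    ℤ→ℚ (f i' ℤ.+ g j') + (δ + (Δf + Δg))    ∎
    where
    open ≤-Reasoning
    Δf = Δof f f̆
    Δg = Δof g ğ

  sumset-column-spread : ∀ {δ a b ℓ} → RelevantBox f̆ ğ δ a b ℓ →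
    ∀ {p q} → InSumset f g a b ℓ p → InSumset f g a b ℓ q → proj₁ p ≡ proj₁ q →
    ℕ→ℚ ℤ.∣ proj₂ p ℤ.- proj₂ q ∣ ≤ δ + (Δof f f̆ + Δof g ğ)
  sumset-column-spread rel (i , j , ai , ia , bj , jb , refl) (i' , j' , ai' , ia' , bj' , jb' , refl)
                           same-x =
    ∣x-y∣≤E (f i ℤ.+ g j) (f i' ℤ.+ g j')
      (relevant⇒sum≤ {i' = i'} {j'} (rel i j ai ia bj jb) (sym same-column))
      (relevant⇒sum≤ {i' = i} {j} (rel i' j' ai' ia' bj' jb') same-column)
    where
    same-column : toℕ i ℕ.+ toℕ j ≡ toℕ i' ℕ.+ toℕ j'
    same-column = ℤP.+-injective same-x

  sumset-size≤ : ∀ {a b ℓ} → RelevantBox f̆ ğ ((Δof f f̆ ⊔ Δof g ğ) + (Δof f f̆ ⊔ Δof g ğ)) a b ℓ →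
    ∀ L → Unique L → All (InSumset f g a b ℓ) L →
    ℕ→ℚ (length L) ≤ ℕ→ℚ 9 * ((Δof f f̆ ⊔ Δof g ğ) * ℕ→ℚ (ℓ ℕ.+ ℓ))
  sumset-size≤ {a} {b} {ℓ} relevant L uniq in-sumset = begin
    ℕ→ℚ (length L)            ≤⟨ length≤-columns-spread (a ℕ.+ b) (ℓ ℕ.+ ℓ) L 0≤E uniq
                                   (All.map (sumset⊆columns {f = f} {g = g}) in-sumset) spread ⟩
    ℕ→ℚ (ℓ ℕ.+ ℓ) * (1ℚ + (E + E))
                              ≤⟨ *-monoˡ-≤-nonNeg (ℕ→ℚ (ℓ ℕ.+ ℓ)) {{nonNegative (0≤ℕ→ℚ (ℓ ℕ.+ ℓ))}}
                                   (+-monoˡ-≤ (E + E) 1≤Δ) ⟩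
    ℕ→ℚ (ℓ ℕ.+ ℓ) * (Δ + (E + E))
                              ≡⟨ solve 2 (λ X d → X :* (d :+ (((d :+ d) :+ (d :+ d)) :+ ((d :+ d) :+ (d :+ d))))
                                                := con (ℕ→ℚ 9) :* (d :* X)) refl (ℕ→ℚ (ℓ ℕ.+ ℓ)) Δ ⟩
    ℕ→ℚ 9 * (Δ * ℕ→ℚ (ℓ ℕ.+ ℓ)) ∎
    where
    open ≤-Reasoning
    Δ = Δof f f̆ ⊔ Δof g ğ
    E = (Δ + Δ) + (Δ + Δ)
    1≤Δ : 1ℚ ≤ Δ
    1≤Δ = ≤-trans (1≤Δof f f̆) (p≤p⊔q (Δof f f̆) (Δof g ğ))
    0≤Δ : 0ℚ ≤ Δ
    0≤Δ = ≤-trans (≤ᵇ⇒≤ _) 1≤Δ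
    0≤E : 0ℚ ≤ E
    0≤E = +-mono-≤ {0ℚ} {_} {0ℚ} (+-mono-≤ {0ℚ} {_} {0ℚ} 0≤Δ 0≤Δ) (+-mono-≤ {0ℚ} {_} {0ℚ} 0≤Δ 0≤Δ)
    spread : ∀ {p q} → p ∈ L → q ∈ L → proj₁ p ≡ proj₁ q → ℕ→ℚ ℤ.∣ proj₂ p ℤ.- proj₂ q ∣ ≤ E
    spread p∈L q∈L same-x = ≤-trans
      (sumset-column-spread relevant (All.lookup in-sumset p∈L) (All.lookup in-sumset q∈L) same-x)
      (+-monoʳ-≤ (Δ + Δ) (+-mono-≤ (p≤p⊔q (Δof f f̆) (Δof g ğ)) (p≤q⊔p (Δof f f̆) (Δof g ğ))))

lemma4p9 : Σ ℕ λ C →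
    ∀ (n m : ℕ) (f : Fin (suc n) → ℤ) (g : Fin (suc m) → ℤ)
    (f̆ : Fin (suc n) → ℚ) (ğ : Fin (suc m) → ℚ) →
    IsLowerEnvelope f f̆ → IsLowerEnvelope g ğ →
    (a b ℓ : ℕ) → a ℕ.+ ℓ ℕ.≤ suc n → b ℕ.+ ℓ ℕ.≤ suc m →
    (∀ (i : Fin (suc n)) (j : Fin (suc m)) →
    a ℕ.≤ toℕ i → toℕ i ℕ.< a ℕ.+ ℓ → b ℕ.≤ toℕ j → toℕ j ℕ.< b ℕ.+ ℓ →
    Relevant f̆ ğ ((Δof f f̆ ⊔ Δof g ğ) + (Δof f f̆ ⊔ Δof g ğ)) i j) →
    ∀ (L : List (ℤ × ℤ)) → Unique L → All (InSumset f g a b ℓ) L →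
    ℕ→ℚ (length L) ≤ ℕ→ℚ C * ((Δof f f̆ ⊔ Δof g ğ) * ℕ→ℚ (ℓ ℕ.+ ℓ))
lemma4p9 = 9 , λ n m f g f̆ ğ (_ , f̆≤f , _) (_ , ğ≤g , _) a b ℓ _ _ →
  sumset-size≤ {f = f} {g = g} f̆≤f ğ≤g
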